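{- Let $\mathscr{P}\subseteq\mathbb{N}^p$ be a polymatroid, $\mathbf{n}\in I(\mathscr{P})\cap\mathbb{N}^p$, and $\mathscr{P}_{\mathbf n}=\mathscr{P}\cap(\mathbf{n}+\mathbb{N}^p)$. Fix a lexicographic order on $\mathbb N^p$ and use it to define the stalactites of both $\mathscr P$ and $\mathscr P_{\mathbf n}$. Then for every $\mathbf{m}\in\mathbb{N}^p$ with $\mathbf m\ge\mathbf n$, $c'_{\mathbf{m}}(\mathscr{P})=c'_{\mathbf{m}}(\mathscr{P}_{\mathbf{n}})$.
   Context: $\mathbb{N}=\{0,1,2,\dots\}$, $[p]=\{1,\dots,p\}$, $\mathbf e_i$ the $i$th standard basis vector, $\mathbf e_J=\sum_{j\in J}\mathbf e_j$, $|\mathbf n|=n_1+\cdots+n_p$, $\le$ the componentwise order. A polymatroid is a finite set $\mathscr{Q}\subseteq\mathbb{N}^p$ whose elements all have the same $|\cdot|$, the rank $\mathrm{rk}(\mathscr Q)$, and which is M-convex: for $\mathbf u,\mathbf v\in\mathscr Q$ and $i$ with $u_i>v_i$ there is $j$ with $u_j<v_j$ and $\mathbf u-\mathbf e_i+\mathbf e_j\in\mathscr Q$. $I(\mathscr Q)=(\mathrm{conv}(\mathscr Q)+\mathbb R^p_{\le0})\cap\mathbb R^p_{\ge0}$. Stalactites of a polymatroid $\mathscr Q$: with the fixed lexicographic order $\prec$ (lex order with respect to some ordering of coordinates), list $\mathscr Q=\{\mathbf a_1\prec\cdots\prec\mathbf a_r\}$. For $\mathbf u\in\mathscr Q$, $V\subseteq\mathscr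 Q$, let $L(\mathbf u;V)$ be the set of $\ell\in[p]$ with $\mathbf u-\mathbf e_\ell+\mathbf e_j\in V$ for some $j\ne\ell$, and $\mathrm{St}(\mathbf u;V)=\{\mathbf u-\mathbf e_J:J\subseteq L(\mathbf u;V)\}$. The stalactites are $\mathrm{St}(\mathbf a_i;\{\mathbf a_1,\dots,\mathbf a_{i-1}\})$, $i=1,\dots,r$, and $c'_{\mathbf m}(\mathscr Q)=(-1)^{\mathrm{rk}(\mathscr Q)-|\mathbf m|}\cdot\#\{i:\mathbf m\in\mathrm{St}(\mathbf a_i;\{\mathbf a_1,\dots,\mathbf a_{i-1}\})\}$. -}

module Defs where

open import Data.Nat as ℕ using (ℕ; zero; suc; _+_; _∸_; _≤_; _<_; _≡ᵇ_; _<ᵇ_; _≤ᵇ_)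
open import Data.Integer as ℤ using (ℤ; +_)
open import Data.Rational as ℚ using (ℚ)
open import Data.Bool using (Bool; true; false; _∧_; _∨_; not; if_then_else_)
open import Data.Fin as Fin using (Fin)
open import Data.Fin.Permutation using (Permutation′; _⟨$⟩ʳ_)
open import Data.Vec as Vec using (Vec; lookup; zipWith; replicate; updateAt)
open import Data.Vec.Properties using (≡-dec)
open import Data.List as List using (List; []; _∷_; length; filterᵇ; allFin; zip)
open import Data.Bool.ListAction using (any; all)
open import Data.List.Membership.Propositional using (_∈_)
open import Data.List.Relation.Unary.Unique.Propositional using (Unique)
open import Data.Product using (Σ; ∃; _×_; _,_)
open import Relation.Nullary.Decidable using (⌊_⌋)
open import Relation.Binary.PropositionalEquality using (_≡_)

Pt : ℕ → Set
Pt p = Vec ℕ p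

∣_∣ᵥ : ∀ {p} → Pt p → ℕ
∣ v ∣ᵥ = Vec.sum v

_≤ᵥ_ : ∀ {p} → Pt p → Pt p → Set
u ≤ᵥ v = ∀ i → lookup u i ≤ lookup v i

-- u - e_i + e_j   (only used when u_i ≥ 1)
exch : ∀ {p} → Pt p → Fin p → Fin p → Pt p
exch u i j = updateAt (updateAt u i (λ x → x ∸ 1)) j suc

-- Polymatroids: a finite set Q ⊆ ℕ^p, represented by a duplicate-free list.

SameRank : ∀ {p} → List (Pt p) → Set
SameRank {p} Q = ∀ (u v : Pt p) → u ∈ Q → v ∈ Q → ∣ u ∣ᵥ ≡ ∣ v ∣ᵥ

MConvex : ∀ {p} → List (Pt p) → Set
MConvex {p} Q = ∀ (u v : Pt p) → u ∈ Q → v ∈ Q → (i : Fin p) →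
  lookup v i < lookup u i →
  ∃ λ (j : Fin p) → (lookup u j < lookup v j) × (exch u i j ∈ Q)

record IsPolymatroid {p : ℕ} (Q : List (Pt p)) : Set where
  field
    unique   : Unique Q
    sameRank : SameRank Q
    mconvex  : MConvex Q

-- rank of a (nonempty) polymatroid: |u| for any element u; 0 for the empty list
rk : ∀ {p} → List (Pt p) → ℕ
rk []      = 0
rk (u ∷ _) = ∣ u ∣ᵥ

-- I(Q) ∩ ℕ^p:  n ∈ ℕ^p with n ≤ x for some x ∈ conv(Q)
-- (convex combinations with rational coefficients)

wsum : ∀ {p} → List ℚ → List (Pt p) → Fin p → ℚ
wsum (w ∷ ws) (u ∷ us) i = w ℚ.* ((+ lookup u i) ℚ./ 1) ℚ.+ wsum ws us i
wsum _        _        i = ℚ.0ℚ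

InI : ∀ {p} → List (Pt p) → Pt p → Set
InI {p} Q n = Σ (List ℚ) λ w →
    (length w ≡ length Q)
  × (∀ c → c ∈ w → ℚ.0ℚ ℚ.≤ c)
  × (List.foldr ℚ._+_ ℚ.0ℚ w ≡ ℚ.1ℚ)
  × (∀ (i : Fin p) → ((+ lookup n i) ℚ./ 1) ℚ.≤ wsum w Q i)

-- Lexicographic order w.r.t. the coordinate ordering σ(0), σ(1), ...:
-- u ≺ v iff at the first coordinate (in this ordering) where they differ, u is smaller.

lexLtL : List ℕ → List ℕ → Bool
lexLtL (x ∷ xs) (y ∷ ys) = (x <ᵇ y) ∨ ((x ≡ᵇ y) ∧ lexLtL xs ys)
lexLtL _        _        = false

reorder : ∀ {p} → Permutation′ p → Pt p → List ℕ
reorder σ u = List.map (λ k → lookup u (σ ⟨$⟩ʳ k)) (allFin _)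

lexLt : ∀ {p} → Permutation′ p → Pt p → Pt p → Bool
lexLt σ u v = lexLtL (reorder σ u) (reorder σ v)

memᵇ : ∀ {p} → Pt p → List (Pt p) → Bool
memᵇ u V = any (λ v → ⌊ ≡-dec ℕ._≟_ u v ⌋) V

inL : ∀ {p} → Pt p → List (Pt p) → Fin p → Bool
inL u V ℓ = (1 ≤ᵇ lookup u ℓ) ∧
  any (λ j → not ⌊ j Fin.≟ ℓ ⌋ ∧ memᵇ (exch u ℓ j) V) (allFin _)

-- m ∈ St(u; V) = { u - e_J : J ⊆ L(u;V) }
inSt : ∀ {p} → Pt p → Pt p → List (Pt p) → Bool
inSt m u V = all
  (λ ℓ → (lookup m ℓ ≡ᵇ lookup u ℓ) ∨ ((suc (lookup m ℓ) ≡ᵇ lookup u ℓ) ∧ inL u V ℓ))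
  (allFin _)

preds : ∀ {p} → Permutation′ p → List (Pt p) → Pt p → List (Pt p)
preds σ Q a = filterᵇ (λ b → lexLt σ b a) Q

stCount : ∀ {p} → Permutation′ p → List (Pt p) → Pt p → ℕ
stCount σ Q m = length (filterᵇ (λ a → inSt m a (preds σ Q a)) Q)

sign : ℕ → ℤ
sign zero          = + 1
sign (suc zero)    = ℤ.- (+ 1)
sign (suc (suc k)) = sign k

-- c'_m(Q) = (-1)^(rk Q - |m|) · #{...}
-- (when |m| > rk Q the count is 0, so the truncated subtraction is harmless)
c′ : ∀ {p} → Permutation′ p → List (Pt p) → Pt p → ℤ
c′ σ Q m = sign (rk Q ∸ ∣ m ∣ᵥ) ℤ.* (+ stCount σ Q m)

restrict : ∀ {p} → List (Pt p) → Pt p → List (Pt p)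
restrict Q n = filterᵇ (λ u → Vec.foldr _ _∧_ true (zipWith _≤ᵇ_ n u)) Q

-- A stalactite St(a; V) only contains points below a, so when m ≥ n only the a ∈ Pₙ
-- can contribute to c′ₘ.  For such an a, a coordinate ℓ can be lowered at m only if
-- a_ℓ − 1 = m_ℓ ≥ n_ℓ, and then every exchange a − e_ℓ + e_j still lies above n: it
-- precedes a in P iff it precedes a in Pₙ.  So the stalactites of P and of Pₙ through a
-- agree at m.  The ranks agree as well, unless Pₙ is empty and both counts vanish.
module Submission where

open import Defs
open import Data.Bool using (Bool; true; false; _∧_; _∨_; not; T; T?)
open import Data.Bool.ListAction using (and; or)
open import Data.Bool.Properties using (T-≡; T-∧; T-∨; ∧-zeroʳ)
open import Data.Empty using (⊥-elim)
open import Data.Fin as Fin using (Fin)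
open import Data.Fin.Permutation using (Permutation′)
open import Data.Integer as ℤ using (+_)
open import Data.Integer.Properties using (*-zeroʳ)
open import Data.List using (List; []; _∷_; filterᵇ; length; allFin)
open import Data.List.Membership.Propositional.Properties using (∈-allFin)
open import Data.List.Properties using (map-cong)
open import Data.List.Relation.Binary.Subset.Propositional using (_⊆_)
open import Data.List.Relation.Binary.Subset.Propositional.Properties using (filter-⊆)
open import Data.List.Relation.Unary.All as All using ()
open import Data.List.Relation.Unary.All.Properties using (all⁺)
open import Data.List.Relation.Unary.Any using (here)
open import Data.Nat as ℕ using (ℕ; suc; _≤_; _∸_; _≤ᵇ_; _≡ᵇ_)
open import Data.Nat.Properties using (≡ᵇ⇒≡; ≤ᵇ⇒≤; ≤⇒≤ᵇ; ≤-trans; ≤-reflexive; m≤n⇒m≤1+n; <⇒≤)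
open import Data.Product using (proj₁; proj₂; _,_)
open import Data.Sum using (_⊎_; inj₁; inj₂)
open import Data.Vec as Vec using (lookup; updateAt; zipWith)
open import Data.Vec.Properties using (≡-dec; lookup∘updateAt; lookup∘updateAt′)
open import Function using (_∘_; Equivalence)
open import Relation.Nullary.Decidable using (yes; no; ⌊_⌋)
open import Relation.Binary.PropositionalEquality

open Equivalence using (to; from)

≡-∧-guarded : ∀ {x} b {y} → (T x → T b) → (T b → x ≡ y) → x ≡ b ∧ y
≡-∧-guarded         true  _   x≡y = x≡y _
≡-∧-guarded {true}  false x⇒b _   = ⊥-elim (x⇒b _)
≡-∧-guarded {false} false _   _   = refl

∧-congˡ-guarded : ∀ s {x y} → (T s → x ≡ y) → s ∧ x ≡ s ∧ y
∧-congˡ-guarded true  x≡y = x≡y _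
∧-congˡ-guarded false _   = refl

filterᵇ-∧ : ∀ {A : Set} {f g h : A → Bool} → (∀ a → f a ≡ h a ∧ g a) →
  ∀ xs → filterᵇ f xs ≡ filterᵇ g (filterᵇ h xs)
filterᵇ-∧ f≡h∧g [] = refl
filterᵇ-∧ {g = g} {h} f≡h∧g (x ∷ xs) rewrite f≡h∧g x with h x
... | false = filterᵇ-∧ f≡h∧g xs
... | true with g x
...   | true  = cong (x ∷_) (filterᵇ-∧ f≡h∧g xs)
...   | false = filterᵇ-∧ f≡h∧g xs

memᵇ-filterᵇ : ∀ {p} (q : Pt p → Bool) x L → memᵇ x (filterᵇ q L) ≡ q x ∧ memᵇ x L
memᵇ-filterᵇ q x [] = sym (∧-zeroʳ (q x))
memᵇ-filterᵇ q x (y ∷ L) with q y in qy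
... | true with ≡-dec ℕ._≟_ x y
...   | yes refl rewrite qy = refl
...   | no _ = memᵇ-filterᵇ q x L
memᵇ-filterᵇ q x (y ∷ L) | false with ≡-dec ℕ._≟_ x y
...   | yes refl rewrite qy = trans (memᵇ-filterᵇ q x L) (cong (_∧ memᵇ x L) qy)
...   | no _ = memᵇ-filterᵇ q x L

rk-⊆ : ∀ {p} {P R : List (Pt p)} → SameRank P → R ⊆ P → R ≡ [] ⊎ rk R ≡ rk P
rk-⊆ {R = []}            _    _   = inj₁ refl
rk-⊆ {P = v ∷ _} {u ∷ _} same R⊆P = inj₂ (same u v (R⊆P (here refl)) (here refl))
rk-⊆ {P = []}    {_ ∷ _} _    R⊆P with () ← R⊆P (here refl)

≤ᵥ-trans : ∀ {p} {u v w : Pt p} → u ≤ᵥ v → v ≤ᵥ w → u ≤ᵥ w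
≤ᵥ-trans u≤v v≤w i = ≤-trans (u≤v i) (v≤w i)

≤ᵥ-updateAt : ∀ {p} {n u : Pt p} (i : Fin p) {f : ℕ → ℕ} →
  n ≤ᵥ u → lookup n i ≤ f (lookup u i) → n ≤ᵥ updateAt u i f
≤ᵥ-updateAt {n = n} {u} i n≤u nᵢ≤ k with k Fin.≟ i
... | yes refl = subst (lookup n k ≤_) (sym (lookup∘updateAt k u)) nᵢ≤
... | no k≢i   = subst (lookup n k ≤_) (sym (lookup∘updateAt′ k i k≢i u)) (n≤u k)

≤ᵥ-exch : ∀ {p} (n a : Pt p) ℓ j → n ≤ᵥ a → lookup n ℓ ≤ lookup a ℓ ∸ 1 → n ≤ᵥ exch a ℓ j
≤ᵥ-exch n a ℓ j n≤a nℓ≤ = ≤ᵥ-updateAt {n = n} {updateAt a ℓ (_∸ 1)} j n≤a-eℓ (m≤n⇒m≤1+n (n≤a-eℓ j))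
  where
  n≤a-eℓ : n ≤ᵥ updateAt a ℓ (_∸ 1)
  n≤a-eℓ = ≤ᵥ-updateAt {n = n} {a} ℓ n≤a nℓ≤

_≤ᵥᵇ_ : ∀ {p} → Pt p → Pt p → Bool
n ≤ᵥᵇ u = Vec.foldr _ _∧_ true (zipWith _≤ᵇ_ n u)

≤ᵥᵇ⇒≤ᵥ : ∀ {p} (n u : Pt p) → T (n ≤ᵥᵇ u) → n ≤ᵥ u
≤ᵥᵇ⇒≤ᵥ (a Vec.∷ n) (b Vec.∷ u) t Fin.zero    = ≤ᵇ⇒≤ a b (proj₁ (to (T-∧ {a ≤ᵇ b}) t))
≤ᵥᵇ⇒≤ᵥ (a Vec.∷ n) (b Vec.∷ u) t (Fin.suc i) = ≤ᵥᵇ⇒≤ᵥ n u (proj₂ (to (T-∧ {a ≤ᵇ b}) t)) i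

≤ᵥ⇒≤ᵥᵇ : ∀ {p} (n u : Pt p) → n ≤ᵥ u → T (n ≤ᵥᵇ u)
≤ᵥ⇒≤ᵥᵇ Vec.[]      Vec.[]      _   = _
≤ᵥ⇒≤ᵥᵇ (_ Vec.∷ n) (_ Vec.∷ u) n≤u =
  from T-∧ (≤⇒≤ᵇ (n≤u Fin.zero) , ≤ᵥ⇒≤ᵥᵇ n u (n≤u ∘ Fin.suc))

≡ᵇ-or-suc≡ᵇ⇒≤ : ∀ x y r → T ((x ≡ᵇ y) ∨ ((suc x ≡ᵇ y) ∧ r)) → x ≤ y
≡ᵇ-or-suc≡ᵇ⇒≤ x y r t with to (T-∨ {x ≡ᵇ y}) t
... | inj₁ x≡y     = ≤-reflexive (≡ᵇ⇒≡ x y x≡y)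
... | inj₂ 1+x≡y∧r = <⇒≤ (≤-reflexive (≡ᵇ⇒≡ (suc x) y (proj₁ (to (T-∧ {suc x ≡ᵇ y}) 1+x≡y∧r))))

inSt⇒≤ᵥ : ∀ {p} (m a : Pt p) {V} → T (inSt m a V) → m ≤ᵥ a
inSt⇒≤ᵥ m a m∈St ℓ = ≡ᵇ-or-suc≡ᵇ⇒≤ (lookup m ℓ) (lookup a ℓ) _
  (All.lookup (all⁺ _ (allFin _) m∈St) (∈-allFin ℓ))

module _ {p : ℕ} (σ : Permutation′ p) (P : List (Pt p)) (n : Pt p) where

  memᵇ-preds-restrict : ∀ a x → T (n ≤ᵥᵇ x) →
    memᵇ x (preds σ P a) ≡ memᵇ x (preds σ (restrict P n) a)
  memᵇ-preds-restrict a x n≤x = begin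
    memᵇ x (filterᵇ before P)                     ≡⟨ memᵇ-filterᵇ before x P ⟩
    before x ∧ memᵇ x P                           ≡⟨ cong (λ b → before x ∧ (b ∧ memᵇ x P)) (to T-≡ n≤x) ⟨
    before x ∧ ((n ≤ᵥᵇ x) ∧ memᵇ x P)             ≡⟨ cong (before x ∧_) (memᵇ-filterᵇ (n ≤ᵥᵇ_) x P) ⟨
    before x ∧ memᵇ x (filterᵇ (n ≤ᵥᵇ_) P)        ≡⟨ memᵇ-filterᵇ before x (filterᵇ (n ≤ᵥᵇ_) P) ⟨
    memᵇ x (filterᵇ before (filterᵇ (n ≤ᵥᵇ_) P))  ∎
    where
    open ≡-Reasoning
    before : Pt p → Bool
    before b = lexLt σ b a

  inL-preds-restrict : ∀ a ℓ → n ≤ᵥ a → lookup n ℓ ≤ lookup a ℓ ∸ 1 →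
    inL a (preds σ P a) ℓ ≡ inL a (preds σ (restrict P n) a) ℓ
  inL-preds-restrict a ℓ n≤a nℓ≤ =
    cong (λ bs → (1 ≤ᵇ lookup a ℓ) ∧ or bs) (map-cong exchange-agrees (allFin _))
    where
    exchange-agrees : ∀ j →
      not ⌊ j Fin.≟ ℓ ⌋ ∧ memᵇ (exch a ℓ j) (preds σ P a)
        ≡ not ⌊ j Fin.≟ ℓ ⌋ ∧ memᵇ (exch a ℓ j) (preds σ (restrict P n) a)
    exchange-agrees j = cong (not ⌊ j Fin.≟ ℓ ⌋ ∧_)
      (memᵇ-preds-restrict a (exch a ℓ j) (≤ᵥ⇒≤ᵥᵇ n (exch a ℓ j) (≤ᵥ-exch n a ℓ j n≤a nℓ≤)))

  inSt-preds-restrict : ∀ m a → n ≤ᵥ m → n ≤ᵥ a →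
    inSt m a (preds σ P a) ≡ inSt m a (preds σ (restrict P n) a)
  inSt-preds-restrict m a n≤m n≤a = cong and (map-cong coordinate-agrees (allFin _))
    where
    lowerable : Fin p → Bool
    lowerable ℓ = suc (lookup m ℓ) ≡ᵇ lookup a ℓ
    coordinate-agrees : ∀ ℓ →
      (lookup m ℓ ≡ᵇ lookup a ℓ) ∨ (lowerable ℓ ∧ inL a (preds σ P a) ℓ)
        ≡ (lookup m ℓ ≡ᵇ lookup a ℓ) ∨ (lowerable ℓ ∧ inL a (preds σ (restrict P n) a) ℓ)
    coordinate-agrees ℓ = cong ((lookup m ℓ ≡ᵇ lookup a ℓ) ∨_)
      (∧-congˡ-guarded (lowerable ℓ) λ 1+mℓ≡aℓ → inL-preds-restrict a ℓ n≤a
        (subst (lookup n ℓ ≤_) (cong (_∸ 1) (≡ᵇ⇒≡ (suc (lookup m ℓ)) (lookup a ℓ) 1+mℓ≡aℓ)) (n≤m ℓ)))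

  stCount-restrict : ∀ m → n ≤ᵥ m → stCount σ P m ≡ stCount σ (restrict P n) m
  stCount-restrict m n≤m = cong length (filterᵇ-∧ stalactite-through P)
    where
    stalactite-through : ∀ a →
      inSt m a (preds σ P a) ≡ (n ≤ᵥᵇ a) ∧ inSt m a (preds σ (restrict P n) a)
    stalactite-through a = ≡-∧-guarded (n ≤ᵥᵇ a)
      (λ m∈St → ≤ᵥ⇒≤ᵥᵇ n a (≤ᵥ-trans {u = n} {m} {a} n≤m (inSt⇒≤ᵥ m a {preds σ P a} m∈St)))
      (λ n≤a → inSt-preds-restrict m a n≤m (≤ᵥᵇ⇒≤ᵥ n a n≤a))

c′-cong : ∀ {p} {σ : Permutation′ p} {P Q : List (Pt p)} {m} →
  stCount σ P m ≡ stCount σ Q m → Q ≡ [] ⊎ rk Q ≡ rk P → c′ σ P m ≡ c′ σ Q m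
c′-cong {σ = σ} {P} {m = m} count≡ (inj₁ refl) = begin
  sign (rk P ∸ ∣ m ∣ᵥ) ℤ.* + stCount σ P m  ≡⟨ cong (λ c → sign (rk P ∸ ∣ m ∣ᵥ) ℤ.* + c) count≡ ⟩
  sign (rk P ∸ ∣ m ∣ᵥ) ℤ.* + 0              ≡⟨ *-zeroʳ (sign (rk P ∸ ∣ m ∣ᵥ)) ⟩
  + 0                                       ≡⟨ *-zeroʳ (sign (0 ∸ ∣ m ∣ᵥ)) ⟨
  sign (0 ∸ ∣ m ∣ᵥ) ℤ.* + 0                 ∎
  where open ≡-Reasoning
c′-cong {m = m} count≡ (inj₂ rk≡) = cong₂ (λ r c → sign (r ∸ ∣ m ∣ᵥ) ℤ.* + c) (sym rk≡) count≡

lemma4p2 : ∀ {p : ℕ} (P : List (Pt p)) → IsPolymatroid P →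
    (n : Pt p) → InI P n →
    (σ : Permutation′ p) →
    (m : Pt p) → n ≤ᵥ m →
    c′ σ P m ≡ c′ σ (restrict P n) m
lemma4p2 P isP n _ σ m n≤m = c′-cong {σ = σ} {P} {m = m}
  (stCount-restrict σ P n m n≤m)
  (rk-⊆ (IsPolymatroid.sameRank isP) (filter-⊆ (T? ∘ (n ≤ᵥᵇ_)) P))
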